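{- Let $\Gamma$ be a distance-regular graph with diameter $D\ge3$ and let $\theta\in\mathbb{C}$. Then the single element $\sum_{i=0}^Df_i(\theta)k_i^{ -1}A_i$ is a basis for $\mathbf{M}(\theta)$.
   Context: $\Gamma=(X,R)$ is a finite connected distance-regular graph with path-length distance $\partial$, diameter $D$ and intersection numbers $p^h_{ij}$; $c_i=p^i_{1,i-1}$, $a_i=p^i_{1,i}$, $b_i=p^i_{1,i+1}$, $k_i=p^0_{ii}$. $A_i$ is the $i$th distance matrix, $A=A_1$, $\mathbf{M}$ the Bose–Mesner algebra generated by $A$ (basis $A_0,\dots,A_D$). The polynomials $f_j$ are defined by $f_{ -1}=0$, $f_0=1$, $\lambda f_j=b_{j-1}f_{j-1}+a_jf_j+c_{j+1}f_{j+1}$ ($0\le j\le D-1$, $b_{ -1}=0$). For $\theta\in\mathbb{C}$, $\mathbf{M}(\theta)=\{Y\in\mathbf{M}:(A-\theta I)Y\in\mathbb{C}A_D\}$. -}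

module Defs where

open import Level using (Level; _⊔_) renaming (suc to lsuc)
open import Algebra.Bundles using (CommutativeRing)
open import Data.Nat using (ℕ; zero; suc; _≤_; _∸_)
open import Data.Fin using (Fin; zero; suc)
open import Data.Fin.Properties using (_≟_)
open import Data.Bool using (Bool; true; false; _∧_; _∨_; not; if_then_else_)
open import Data.Product using (Σ; _×_; ∃; ∃₂)
open import Relation.Nullary using (¬_; does)
open import Relation.Binary.PropositionalEquality using (_≡_)

-- Scalars: a field of characteristic zero (stand-in for ℂ).
-- The inverse is total; it is only constrained on non-zero elements.

natR : ∀ {c ℓ} (R : CommutativeRing c ℓ) → ℕ → CommutativeRing.Carrier R
natR R zero    = CommutativeRing.0# R
natR R (suc m) = CommutativeRing._+_ R (CommutativeRing.1# R) (natR R m)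

record CharZeroField c ℓ : Set (lsuc (c ⊔ ℓ)) where
  field
    commutativeRing : CommutativeRing c ℓ
  open CommutativeRing commutativeRing public
  field
    _⁻¹      : Carrier → Carrier
    inverseʳ : ∀ x → ¬ (x ≈ 0#) → (x * (x ⁻¹)) ≈ 1#
    charZero : ∀ m → ¬ (natR commutativeRing (suc m) ≈ 0#)
  nat : ℕ → Carrier
  nat = natR commutativeRing

record Graph (n : ℕ) : Set where
  field
    adj    : Fin n → Fin n → Bool
    sym    : ∀ x y → adj x y ≡ adj y x
    irrefl : ∀ x → adj x x ≡ false

anyFin : ∀ {m} → (Fin m → Bool) → Bool
anyFin {zero}  f = false
anyFin {suc m} f = f zero ∨ anyFin (λ z → f (suc z))

count : ∀ {m} → (Fin m → Bool) → ℕ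
count {zero}  f = 0
count {suc m} f = (if f zero then 1 else 0) Data.Nat.+ count (λ z → f (suc z))

anyBelow : ℕ → (ℕ → Bool) → Bool
anyBelow zero    P = false
anyBelow (suc i) P = P i ∨ anyBelow i P

module _ {n : ℕ} (G : Graph n) where
  open Graph G

  walk : ℕ → Fin n → Fin n → Bool
  walk zero    x y = does (x ≟ y)
  walk (suc k) x y = anyFin (λ z → adj x z ∧ walk k z y)

  distIs : ℕ → Fin n → Fin n → Bool
  distIs i x y = walk i x y ∧ not (anyBelow i (λ j → walk j x y))

  -- Γ is connected with diameter D and is distance-regular with
  -- intersection numbers p h i j = p^h_{ij}
  record IsDRG (D : ℕ) (p : ℕ → ℕ → ℕ → ℕ) : Set where
    field
      bounded   : ∀ x y → ∃ λ i → i ≤ D × distIs i x y ≡ true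
      attained  : ∃₂ λ x y → distIs D x y ≡ true
      intersect : ∀ h i j x y → distIs h x y ≡ true →
                  count (λ z → distIs i x z ∧ distIs j z y) ≡ p h i j

cN aN bN kN : (ℕ → ℕ → ℕ → ℕ) → ℕ → ℕ
cN p i = p i 1 (i ∸ 1)
aN p i = p i 1 i
bN p i = p i 1 (suc i)
kN p i = p 0 i i

module _ {c ℓ : Level} (K : CharZeroField c ℓ) where
  open CharZeroField K using (Carrier; _≈_; _+_; _*_; _-_; 0#; 1#; _⁻¹; nat)

  Mat : ℕ → Set c
  Mat n = Fin n → Fin n → Carrier

  _≈M_ : ∀ {n} → Mat n → Mat n → Set ℓ
  X ≈M Y = ∀ x y → X x y ≈ Y x y

  zeroM idM : ∀ {n} → Mat n
  zeroM x y = 0#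
  idM x y = if does (x ≟ y) then 1# else 0#

  _+M_ _-M_ : ∀ {n} → Mat n → Mat n → Mat n
  (X +M Y) x y = X x y + Y x y
  (X -M Y) x y = X x y - Y x y

  _·M_ : ∀ {n} → Carrier → Mat n → Mat n
  (γ ·M X) x y = γ * X x y

  sumFin : ∀ {m} → (Fin m → Carrier) → Carrier
  sumFin {zero}  f = 0#
  sumFin {suc m} f = f zero + sumFin (λ z → f (suc z))

  _*M_ : ∀ {n} → Mat n → Mat n → Mat n
  (X *M Y) x y = sumFin (λ z → X x z * Y z y)

  sumTo : ∀ {n} → ℕ → (ℕ → Mat n) → Mat n
  sumTo zero    F = F 0
  sumTo (suc i) F = sumTo i F +M F (suc i)

  module _ {n : ℕ} (G : Graph n) (D : ℕ) (p : ℕ → ℕ → ℕ → ℕ) where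

    distMat : ℕ → Mat n
    distMat i x y = if distIs G i x y then 1# else 0#

    adjMat : Mat n
    adjMat = distMat 1

    InM : Mat n → Set (c ⊔ ℓ)
    InM Y = Σ (ℕ → Carrier) λ α → Y ≈M sumTo D (λ i → α i ·M distMat i)

    InMθ : Carrier → Mat n → Set (c ⊔ ℓ)
    InMθ θ Y = InM Y × Σ Carrier λ β →
               ((adjMat -M (θ ·M idM)) *M Y) ≈M (β ·M distMat D)

    -- f_j(θ), from f_{-1} = 0, f_0 = 1 and
    -- θ f_j = b_{j-1} f_{j-1} + a_j f_j + c_{j+1} f_{j+1}  (b_{-1} = 0)
    fval : Carrier → ℕ → Carrier
    fval θ zero          = 1#
    fval θ (suc zero)    = ((θ - nat (aN p 0)) * fval θ 0) * (nat (cN p 1) ⁻¹)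
    fval θ (suc (suc j)) =
      (((θ - nat (aN p (suc j))) * fval θ (suc j)) - (nat (bN p j) * fval θ j))
        * (nat (cN p (suc (suc j))) ⁻¹)

    Yθ : Carrier → Mat n
    Yθ θ = sumTo D (λ i → (fval θ i * (nat (kN p i) ⁻¹)) ·M distMat i)

  IsBasis1 : ∀ {n} {a} → (Mat n → Set a) → Mat n → Set (c ⊔ ℓ ⊔ a)
  IsBasis1 S Y = S Y
               × (∀ γ → (γ ·M Y) ≈M zeroM → γ ≈ 0#)
               × (∀ Z → S Z → Σ Carrier λ γ → Z ≈M (γ ·M Y))

module Submission where

-- Write Z ∈ 𝐌 as Σᵢ αᵢ Aᵢ, so that Z x y = α (∂ x y). Counting the neighbours of x at each distance
-- from y gives A Z = Σₕ (c_h α_{h-1} + a_h α_h + b_h α_{h+1}) A_h, so Z ∈ 𝐌(θ) exactly when α satisfies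
-- this three-term recurrence with eigenvalue θ in every row h < D. Since b_h ≠ 0 for h < D, a solution
-- is determined by α₀, so 𝐌(θ) is spanned by any Σᵢ vᵢ Aᵢ with v a solution and v₀ ≠ 0. Double
-- counting gives k_h b_h = k_{h+1} c_{h+1}, which turns the recurrence defining the f_i into this one
-- for vᵢ = f_i(θ) / k_i, and v₀ = 1 / k₀.

open import Defs
open import Algebra.Bundles using (CommutativeRing)
open import Data.Nat as ℕ using (ℕ; zero; suc; _≤_; _<_; _∸_; z≤n; s≤s)
import Data.Nat.Properties as ℕ
open import Data.Fin using (Fin; zero; suc)
open import Data.Fin.Properties using (_≟_; suc-injective)
open import Data.Bool using (Bool; true; false; _∧_; not; if_then_else_)
open import Data.Bool.Properties using (∧-conicalˡ; ∧-conicalʳ; ∨-zeroʳ; ∧-idem; ∧-comm; ∧-assoc)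
open import Data.Product using (Σ; ∃-syntax; _×_; _,_; proj₁; proj₂)
open import Data.Sum using (inj₁; inj₂)
open import Function using (_∘_)
open import Relation.Nullary using (Dec; ¬_; does; yes; no; contradiction)
open import Relation.Nullary.Decidable using (dec-true; dec-false)
open import Relation.Binary.PropositionalEquality as ≡ using (_≡_; _≢_)

module FinitePredicates where
  open ≡ using (refl; sym; trans; cong; cong₂; module ≡-Reasoning)
  open import Algebra.Properties.CommutativeMonoid.Sum ℕ.+-0-commutativeMonoid
    using (sum-cong-≗; ∑-comm) renaming (sum to ∑ℕ)

  anyFin-intro : ∀ {m} (f : Fin m → Bool) z → f z ≡ true → anyFin f ≡ true
  anyFin-intro f zero    fz≡true rewrite fz≡true = refl
  anyFin-intro f (suc z) fz≡true
    rewrite anyFin-intro (λ w → f (suc w)) z fz≡true = ∨-zeroʳ (f zero)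

  anyFin-elim : ∀ {m} (f : Fin m → Bool) → anyFin f ≡ true → ∃[ z ] f z ≡ true
  anyFin-elim {suc m} f any≡true with f zero in f₀≡b
  ... | true  = zero , f₀≡b
  ... | false with anyFin-elim (λ w → f (suc w)) any≡true
  ...   | z , fz≡true = suc z , fz≡true

  anyBelow-intro : ∀ {i j} (Q : ℕ → Bool) → j < i → Q j ≡ true → anyBelow i Q ≡ true
  anyBelow-intro {suc i} {j} Q j<1+i Qj≡true with j ℕ.≟ i
  ... | yes refl rewrite Qj≡true = refl
  ... | no j≢i
    rewrite anyBelow-intro Q (ℕ.≤∧≢⇒< (ℕ.≤-pred j<1+i) j≢i) Qj≡true = ∨-zeroʳ (Q i)

  count-cong : ∀ {m} {f g : Fin m → Bool} → (∀ z → f z ≡ g z) → count f ≡ count g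
  count-cong {zero}  f≗g = refl
  count-cong {suc m} f≗g =
    cong₂ (λ b c → (if b then 1 else 0) ℕ.+ c) (f≗g zero) (count-cong (λ z → f≗g (suc z)))

  count-false : ∀ m → count {m} (λ _ → false) ≡ 0
  count-false zero    = refl
  count-false (suc m) = count-false m

  count-witness : ∀ {m} (f : Fin m → Bool) z → f z ≡ true → 1 ≤ count f
  count-witness f zero    fz≡true rewrite fz≡true = s≤s z≤n
  count-witness f (suc z) fz≡true =
    ℕ.≤-trans (count-witness (λ w → f (suc w)) z fz≡true) (ℕ.m≤n+m _ _)

  count≡∑ : ∀ {m} (f : Fin m → Bool) → count f ≡ ∑ℕ (λ z → if f z then 1 else 0)
  count≡∑ {zero}  f = refl
  count≡∑ {suc m} f = cong ((if f zero then 1 else 0) ℕ.+_) (count≡∑ (λ z → f (suc z)))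

  ∑-count-comm : ∀ {m k} (R : Fin m → Fin k → Bool) →
                 ∑ℕ (λ z → count (R z)) ≡ ∑ℕ (λ w → count (λ z → R z w))
  ∑-count-comm R = begin
    ∑ℕ (λ z → count (R z))                         ≡⟨ sum-cong-≗ (λ z → count≡∑ (R z)) ⟩
    ∑ℕ (λ z → ∑ℕ (λ w → if R z w then 1 else 0))   ≡⟨ ∑-comm (λ z w → if R z w then 1 else 0) ⟩
    ∑ℕ (λ w → ∑ℕ (λ z → if R z w then 1 else 0))   ≡⟨ sum-cong-≗ (λ w → count≡∑ (λ z → R z w)) ⟨
    ∑ℕ (λ w → count (λ z → R z w))                 ∎
    where open ≡-Reasoning

  ∑-count-fibres : ∀ {m k} (P : Fin m → Bool) (Q : Fin m → Fin k → Bool) c →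
                   (∀ z → P z ≡ true → count (Q z) ≡ c) →
                   ∑ℕ (λ z → count (λ w → P z ∧ Q z w)) ≡ count P ℕ.* c
  ∑-count-fibres {zero}  P Q c fibre = refl
  ∑-count-fibres {suc m} {k} P Q c fibre =
    trans (cong₂ ℕ._+_ first rest) (sym (ℕ.*-distribʳ-+ c (if P zero then 1 else 0) _))
    where
    first : count (λ w → P zero ∧ Q zero w) ≡ (if P zero then 1 else 0) ℕ.* c
    first with P zero in P0≡b
    ... | true  = trans (fibre zero P0≡b) (sym (ℕ.+-identityʳ c))
    ... | false = count-false k
    rest : ∑ℕ (λ z → count (λ w → P (suc z) ∧ Q (suc z) w)) ≡ count (λ z → P (suc z)) ℕ.* c
    rest = ∑-count-fibres (λ z → P (suc z)) (λ z → Q (suc z)) c (λ z → fibre (suc z))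

open FinitePredicates

module Walks {n : ℕ} (G : Graph n) where
  open ≡ using (refl; trans; cong₂; subst)
  open Graph G using (adj)

  walk-refl : ∀ x → walk G 0 x x ≡ true
  walk-refl x = dec-true (x ≟ x) refl

  walk-∷ : ∀ {k x u y} → adj x u ≡ true → walk G k u y ≡ true → walk G (suc k) x y ≡ true
  walk-∷ {k} {x} {u} {y} xu uy = anyFin-intro (λ z → adj x z ∧ walk G k z y) u (cong₂ _∧_ xu uy)

  walk-∷⁻ : ∀ {k x y} → walk G (suc k) x y ≡ true → ∃[ u ] adj x u ≡ true × walk G k u y ≡ true
  walk-∷⁻ {k} {x} {y} xy with anyFin-elim (λ z → adj x z ∧ walk G k z y) xy
  ... | u , xu∧uy = u , ∧-conicalˡ _ _ xu∧uy , ∧-conicalʳ _ _ xu∧uy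

  walk-++ : ∀ {i j x z y} → walk G i x z ≡ true → walk G j z y ≡ true → walk G (i ℕ.+ j) x y ≡ true
  walk-++ {zero} {x = x} {z} xz zy with x ≟ z | xz
  ... | yes refl | _ = zy
  walk-++ {suc i} {j} xz zy with walk-∷⁻ {i} xz
  ... | u , xu , uz = walk-∷ {i ℕ.+ j} xu (walk-++ {i} uz zy)

  walk-sym : ∀ {k x y} → walk G k x y ≡ true → walk G k y x ≡ true
  walk-sym {zero} {x} {y} xy with x ≟ y | xy
  ... | yes refl | _ = walk-refl x
  walk-sym {suc k} {x} {y} xy with walk-∷⁻ {k} xy
  ... | u , xu , uy = subst (λ l → walk G l y x ≡ true) (ℕ.+-comm k 1)
                        (walk-++ {k} (walk-sym {k} uy) (walk-∷ {0} (trans (Graph.sym G u x) xu) (walk-refl x)))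

  distIs-minimal : ∀ {i j x y} → distIs G i x y ≡ true → walk G j x y ≡ true → i ≤ j
  distIs-minimal {i} {j} {x} {y} xy walk-j with i ℕ.≤? j
  ... | yes i≤j = i≤j
  ... | no i≰j  = contradiction
    (subst (λ b → not b ≡ true) (anyBelow-intro _ (ℕ.≰⇒> i≰j) walk-j) (∧-conicalʳ _ _ xy)) λ ()

module DistanceRegular {n : ℕ} {G : Graph n} {D : ℕ} {p : ℕ → ℕ → ℕ → ℕ} (drg : IsDRG G D p) where
  open ≡ using (refl; sym; trans; cong; cong₂; subst; module ≡-Reasoning)
  open import Algebra.Properties.CommutativeMonoid.Sum ℕ.+-0-commutativeMonoid
    using (sum-cong-≗) renaming (sum to ∑ℕ)
  open IsDRG drg
  open Walks G

  dist : Fin n → Fin n → ℕ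
  dist x y = proj₁ (bounded x y)

  dist≤D : ∀ x y → dist x y ≤ D
  dist≤D x y = proj₁ (proj₂ (bounded x y))

  distIs-dist : ∀ x y → distIs G (dist x y) x y ≡ true
  distIs-dist x y = proj₂ (proj₂ (bounded x y))

  walk-dist : ∀ x y → walk G (dist x y) x y ≡ true
  walk-dist x y = ∧-conicalˡ _ _ (distIs-dist x y)

  dist-minimal : ∀ {k x y} → walk G k x y ≡ true → dist x y ≤ k
  dist-minimal {x = x} {y} = distIs-minimal (distIs-dist x y)

  distIs⇒≡dist : ∀ {i x y} → distIs G i x y ≡ true → i ≡ dist x y
  distIs⇒≡dist {i} {x} {y} xy =
    ℕ.≤-antisym (distIs-minimal xy (walk-dist x y)) (dist-minimal {i} (∧-conicalˡ _ _ xy))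

  distIs-at : ∀ {i x y} → dist x y ≡ i → distIs G i x y ≡ true
  distIs-at {x = x} {y} refl = distIs-dist x y

  distIs-off : ∀ {i x y} → i ≢ dist x y → distIs G i x y ≡ false
  distIs-off {i} {x} {y} i≢d with distIs G i x y in xy
  ... | true  = contradiction (distIs⇒≡dist xy) i≢d
  ... | false = refl

  distIs≡ : ∀ i x y → distIs G i x y ≡ does (dist x y ℕ.≟ i)
  distIs≡ i x y with dist x y ℕ.≟ i in d≟i
  ... | yes d≡i = trans (distIs-at d≡i) (sym (cong does d≟i))
  ... | no d≢i  = trans (distIs-off (λ i≡d → d≢i (sym i≡d))) (sym (cong does d≟i))

  dist-refl : ∀ x → dist x x ≡ 0
  dist-refl x = ℕ.n≤0⇒n≡0 (dist-minimal {0} (walk-refl x))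

  dist-sym : ∀ x y → dist x y ≡ dist y x
  dist-sym x y = ℕ.≤-antisym (dist-minimal (walk-sym {dist y x} (walk-dist y x)))
                             (dist-minimal (walk-sym {dist x y} (walk-dist x y)))

  dist-triangle : ∀ x z y → dist x y ≤ dist x z ℕ.+ dist z y
  dist-triangle x z y = dist-minimal (walk-++ {dist x z} (walk-dist x z) (walk-dist z y))

  neighbour-dist : ∀ {x z} y → dist x z ≡ 1 → dist x y ≤ suc (dist z y) × dist z y ≤ suc (dist x y)
  neighbour-dist {x} {z} y xz≡1 =
      subst (λ d → dist x y ≤ d ℕ.+ dist z y) xz≡1 (dist-triangle x z y)
    , subst (λ d → dist z y ≤ d ℕ.+ dist x y) (trans (dist-sym z x) xz≡1) (dist-triangle z x y)

  geodesic-step : ∀ {m x y} → dist x y ≡ suc m → ∃[ z ] dist x z ≡ 1 × dist z y ≡ m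
  geodesic-step {m} {x} {y} xy≡1+m
    with walk-∷⁻ {m} (subst (λ k → walk G k x y ≡ true) xy≡1+m (walk-dist x y))
  ... | z , xz , zy = z , squeeze (dist-minimal {1} (walk-∷ {0} xz (walk-refl z)))
                                  (dist-minimal {m} zy)
                                  (subst (_≤ dist x z ℕ.+ dist z y) xy≡1+m (dist-triangle x z y))
    where
    squeeze : ∀ {a b} → a ≤ 1 → b ≤ m → suc m ≤ a ℕ.+ b → a ≡ 1 × b ≡ m
    squeeze z≤n       b≤m 1+m≤b       = contradiction (ℕ.≤-trans 1+m≤b b≤m) (ℕ.1+n≰n)
    squeeze (s≤s z≤n) b≤m (s≤s m≤b)   = refl , ℕ.≤-antisym b≤m m≤b

  -- An end of a pair at distance D, so that every distance m ≤ D is attained from y₀.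
  y₀ : Fin n
  y₀ = proj₁ (proj₂ attained)

  at-distance : ∀ {m} → m ≤ D → ∃[ z ] dist z y₀ ≡ m
  at-distance {m} m≤D =
    descend (D ∸ m) (trans (sym (distIs⇒≡dist (proj₂ (proj₂ attained)))) (sym (ℕ.m∸n+n≡m m≤D)))
    where
    descend : ∀ k {x} → dist x y₀ ≡ k ℕ.+ m → ∃[ z ] dist z y₀ ≡ m
    descend zero    {x} xy≡m   = x , xy≡m
    descend (suc k) xy≡1+k+m with geodesic-step xy≡1+k+m
    ... | z , _ , zy≡k+m = descend k zy≡k+m

  intersection-witness : ∀ {i j} x z y → dist x z ≡ i → dist z y ≡ j → 1 ≤ p (dist x y) i j
  intersection-witness {i} {j} x z y xz≡i zy≡j =
    subst (1 ≤_) (intersect _ i j x y (distIs-dist x y))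
          (count-witness _ z (cong₂ _∧_ (distIs-at xz≡i) (distIs-at zy≡j)))

  c-positive : ∀ {m} → suc m ≤ D → 1 ≤ cN p (suc m)
  c-positive m<D with at-distance m<D
  ... | z , zy≡1+m with geodesic-step zy≡1+m
  ...   | w , zw≡1 , wy≡m = subst (λ h → 1 ≤ p h 1 _) zy≡1+m (intersection-witness z w y₀ zw≡1 wy≡m)

  b-positive : ∀ {m} → suc m ≤ D → 1 ≤ bN p m
  b-positive m<D with at-distance m<D
  ... | z , zy≡1+m with geodesic-step zy≡1+m
  ...   | w , zw≡1 , wy≡m =
    subst (λ h → 1 ≤ p h 1 _) wy≡m (intersection-witness w z y₀ (trans (dist-sym w z) zw≡1) zy≡1+m)

  k-positive : ∀ {m} → m ≤ D → 1 ≤ kN p m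
  k-positive m≤D with at-distance m≤D
  ... | z , zy≡m =
    subst (λ h → 1 ≤ p h _ _) (dist-refl y₀)
          (intersection-witness y₀ z y₀ (trans (dist-sym y₀ z) zy≡m) zy≡m)

  distIs-sym : ∀ i x y → distIs G i x y ≡ distIs G i y x
  distIs-sym i x y = trans (distIs≡ i x y)
                           (trans (cong (λ d → does (d ℕ.≟ i)) (dist-sym x y)) (sym (distIs≡ i y x)))

  sphere-size : ∀ m x → count (λ z → distIs G m z x) ≡ kN p m
  sphere-size m x = trans (count-cong doubled) (intersect 0 m m x x (distIs-at (dist-refl x)))
    where
    doubled : ∀ z → distIs G m z x ≡ distIs G m x z ∧ distIs G m z x
    doubled z = trans (sym (∧-idem _)) (cong (_∧ distIs G m z x) (distIs-sym m z x))

  -- Both sides count the pairs (z, w) with ∂(z, y₀) = m, ∂(z, w) = 1 and ∂(w, y₀) = m + 1.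
  k-relation : ∀ m → kN p m ℕ.* bN p m ≡ kN p (suc m) ℕ.* cN p (suc m)
  k-relation m = begin
    kN p m ℕ.* bN p m
      ≡⟨ cong (ℕ._* bN p m) (sphere-size m y₀) ⟨
    count inner ℕ.* bN p m
      ≡⟨ ∑-count-fibres inner (λ z w → edge z w ∧ outer w) _ (λ z → intersect m 1 (suc m) z y₀) ⟨
    ∑ℕ (λ z → count (λ w → inner z ∧ (edge z w ∧ outer w)))
      ≡⟨ ∑-count-comm (λ z w → inner z ∧ (edge z w ∧ outer w)) ⟩
    ∑ℕ (λ w → count (λ z → inner z ∧ (edge z w ∧ outer w)))
      ≡⟨ sum-cong-≗ (λ w → count-cong (λ z → flip z w)) ⟩
    ∑ℕ (λ w → count (λ z → outer w ∧ (edge w z ∧ inner z)))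
      ≡⟨ ∑-count-fibres outer (λ w z → edge w z ∧ inner z) _ (λ w → intersect (suc m) 1 m w y₀) ⟩
    count outer ℕ.* cN p (suc m)
      ≡⟨ cong (ℕ._* cN p (suc m)) (sphere-size (suc m) y₀) ⟩
    kN p (suc m) ℕ.* cN p (suc m) ∎
    where
    open ≡-Reasoning
    inner outer : Fin n → Bool
    inner z = distIs G m z y₀
    outer w = distIs G (suc m) w y₀
    edge : Fin n → Fin n → Bool
    edge = distIs G 1
    flip : ∀ z w → inner z ∧ (edge z w ∧ outer w) ≡ outer w ∧ (edge w z ∧ inner z)
    flip z w = begin
      inner z ∧ (edge z w ∧ outer w)   ≡⟨ ∧-comm (inner z) _ ⟩
      (edge z w ∧ outer w) ∧ inner z   ≡⟨ cong (_∧ inner z) (∧-comm (edge z w) _) ⟩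
      (outer w ∧ edge z w) ∧ inner z   ≡⟨ ∧-assoc (outer w) _ _ ⟩
      outer w ∧ (edge z w ∧ inner z)   ≡⟨ cong (λ b → outer w ∧ (b ∧ inner z)) (distIs-sym 1 z w) ⟩
      outer w ∧ (edge w z ∧ inner z)   ∎

module CommutativeRingLemmas {c ℓ} (R : CommutativeRing c ℓ) where
  open CommutativeRing R
  open import Algebra.Properties.Group +-group using (//-rightDividesˡ)
  open import Algebra.Properties.Semiring.Mult semiring using (×1-homo-*) renaming (_×_ to _·ℕ_)
  open import Algebra.Properties.CommutativeSemigroup *-commutativeSemigroup using (x∙yz≈y∙xz; xy∙z≈y∙xz)
  open import Relation.Binary.Reasoning.Setoid setoid

  natR-* : ∀ m n → natR R (m ℕ.* n) ≈ natR R m * natR R n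
  natR-* m n = begin
    natR R (m ℕ.* n)        ≡⟨ natR≡×1 (m ℕ.* n) ⟩
    (m ℕ.* n) ·ℕ 1#         ≈⟨ ×1-homo-* m n ⟩
    (m ·ℕ 1#) * (n ·ℕ 1#)   ≡⟨ ≡.cong₂ _*_ (natR≡×1 m) (natR≡×1 n) ⟨
    natR R m * natR R n     ∎
    where
    natR≡×1 : ∀ k → natR R k ≡ k ·ℕ 1#
    natR≡×1 zero    = ≡.refl
    natR≡×1 (suc k) = ≡.cong (1# +_) (natR≡×1 k)

  x≈γ*y⇒a*x≈γ*[a*y] : ∀ a {x y} γ → x ≈ γ * y → a * x ≈ γ * (a * y)
  x≈γ*y⇒a*x≈γ*[a*y] a {y = y} γ x≈γy = trans (*-congˡ x≈γy) (x∙yz≈y∙xz a γ y)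

  a+[t-a]≈t : ∀ a t → a + (t - a) ≈ t
  a+[t-a]≈t a t = trans (+-comm a (t - a)) (//-rightDividesˡ a t)

  a*x+[t-a]*x≈t*x : ∀ a t x → a * x + (t - a) * x ≈ t * x
  a*x+[t-a]*x≈t*x a t x = trans (sym (distribʳ x a (t - a))) (*-congʳ (a+[t-a]≈t a t))

  [y+a]+[x-y]≈a+x : ∀ y a x → (y + a) + (x - y) ≈ a + x
  [y+a]+[x-y]≈a+x y a x = begin
    (y + a) + (x - y)   ≈⟨ +-congʳ (+-comm y a) ⟩
    (a + y) + (x - y)   ≈⟨ +-assoc a y (x - y) ⟩
    a + (y + (x - y))   ≈⟨ +-congˡ (a+[t-a]≈t y x) ⟩
    a + x               ∎

  k*[c*y]≈c′*f : ∀ {k c k′ c′ y f} → k * c ≈ k′ * c′ → k′ * y ≈ f → k * (c * y) ≈ c′ * f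
  k*[c*y]≈c′*f {k} {c} {k′} {c′} {y} {f} kc≈k′c′ k′y≈f = begin
    k * (c * y)     ≈⟨ *-assoc k c y ⟨
    (k * c) * y     ≈⟨ *-congʳ kc≈k′c′ ⟩
    (k′ * c′) * y   ≈⟨ xy∙z≈y∙xz k′ c′ y ⟩
    c′ * (k′ * y)   ≈⟨ *-congˡ k′y≈f ⟩
    c′ * f          ∎

module FieldLemmas {c ℓ} (K : CharZeroField c ℓ) where
  open CharZeroField K hiding (zero)
  open import Algebra.Properties.CommutativeSemigroup *-commutativeSemigroup using (x∙yz≈y∙xz)
  open import Relation.Binary.Reasoning.Setoid setoid

  nat≉0 : ∀ {m} → 1 ≤ m → ¬ nat m ≈ 0#
  nat≉0 {suc m} _ = charZero m

  x*[y*x⁻¹]≈y : ∀ {x} y → ¬ x ≈ 0# → x * (y * x ⁻¹) ≈ y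
  x*[y*x⁻¹]≈y {x} y x≉0 = begin
    x * (y * x ⁻¹)   ≈⟨ x∙yz≈y∙xz x y (x ⁻¹) ⟩
    y * (x * x ⁻¹)   ≈⟨ *-congˡ (inverseʳ x x≉0) ⟩
    y * 1#           ≈⟨ *-identityʳ y ⟩
    y                ∎

  *-cancelˡ-≉0 : ∀ {x u v} → ¬ x ≈ 0# → x * u ≈ x * v → u ≈ v
  *-cancelˡ-≉0 {x} {u} {v} x≉0 xu≈xv = begin
    u                ≈⟨ x*[y*x⁻¹]≈y u x≉0 ⟨
    x * (u * x ⁻¹)   ≈⟨ *-assoc x u (x ⁻¹) ⟨
    (x * u) * x ⁻¹   ≈⟨ *-congʳ xu≈xv ⟩
    (x * v) * x ⁻¹   ≈⟨ *-assoc x v (x ⁻¹) ⟩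
    x * (v * x ⁻¹)   ≈⟨ x*[y*x⁻¹]≈y v x≉0 ⟩
    v                ∎

module FiniteSums {c ℓ} (R : CommutativeRing c ℓ) where
  open CommutativeRing R hiding (zero)
  open import Algebra.Properties.Semiring.Sum semiring
  open import Relation.Binary.Reasoning.Setoid setoid

  I : Bool → Carrier
  I b = if b then 1# else 0#

  I-yes : ∀ {a} {P : Set a} (P? : Dec P) → P → ∀ x → I (does P?) * x ≈ x
  I-yes P? p x = trans (*-congʳ (reflexive (≡.cong I (dec-true P? p)))) (*-identityˡ x)

  I-no : ∀ {a} {P : Set a} (P? : Dec P) → ¬ P → ∀ x → I (does P?) * x ≈ 0#
  I-no P? ¬p x = trans (*-congʳ (reflexive (≡.cong I (dec-false P? ¬p)))) (zeroˡ x)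

  ∑-zero : ∀ {n} (f : Fin n → Carrier) → (∀ z → f z ≈ 0#) → ∑[ z < n ] f z ≈ 0#
  ∑-zero {n} f f≈0 = trans (sum-cong-≋ f≈0) (sum-replicate-zero n)

  ∑-single : ∀ {n} (f : Fin n → Carrier) x → (∀ z → z ≢ x → f z ≈ 0#) → ∑[ z < n ] f z ≈ f x
  ∑-single f zero    f≈0 =
    trans (+-congˡ (∑-zero _ (λ z → f≈0 (suc z) λ ()))) (+-identityʳ (f zero))
  ∑-single f (suc x) f≈0 =
    trans (+-cong (f≈0 zero λ ()) (∑-single _ x (λ z z≢x → f≈0 (suc z) (z≢x ∘ suc-injective))))
          (+-identityˡ (f (suc x)))

  ∑-indicator : ∀ {n} (b : Fin n → Bool) k → ∑[ z < n ] (I (b z) * k) ≈ natR R (count b) * k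
  ∑-indicator {zero}  b k = sym (zeroˡ k)
  ∑-indicator {suc n} b k with b zero
  ... | true  = trans (+-cong (*-identityˡ k) (∑-indicator (λ z → b (suc z)) k))
                      (sym (trans (distribʳ k 1# _) (+-congʳ (*-identityˡ k))))
  ... | false = trans (+-cong (zeroˡ k) (∑-indicator (λ z → b (suc z)) k)) (+-identityˡ _)

  window : ℕ → ℕ → (ℕ → Carrier) → Carrier
  window s zero    g = 0#
  window s (suc ℓ) g = g s + window (suc s) ℓ g

  window-cong : ∀ ℓ s {g h : ℕ → Carrier} → (∀ j → s ≤ j → g j ≈ h j) →
                window s ℓ g ≈ window s ℓ h
  window-cong zero    s g≈h = refl
  window-cong (suc ℓ) s g≈h =
    +-cong (g≈h s ℕ.≤-refl) (window-cong ℓ (suc s) (λ j s<j → g≈h j (ℕ.<⇒≤ s<j)))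

  window-zero : ∀ ℓ s {g : ℕ → Carrier} → (∀ j → s ≤ j → g j ≈ 0#) → window s ℓ g ≈ 0#
  window-zero ℓ s g≈0 = trans (window-cong ℓ s g≈0) (all-zero ℓ s)
    where
    all-zero : ∀ ℓ s → window s ℓ (λ _ → 0#) ≈ 0#
    all-zero zero    s = refl
    all-zero (suc ℓ) s = trans (+-identityˡ _) (all-zero ℓ (suc s))

  window-δ : ∀ ℓ s {d} (g : ℕ → Carrier) → s ≤ d → d < ℓ ℕ.+ s →
             window s ℓ (λ j → I (does (d ℕ.≟ j)) * g j) ≈ g d
  window-δ zero    s g s≤d d<s = contradiction s≤d (ℕ.<⇒≱ d<s)
  window-δ (suc ℓ) s {d} g s≤d d<ℓ+s with d ℕ.≟ s
  ... | yes ≡.refl =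
    trans (+-cong (I-yes (d ℕ.≟ d) ≡.refl (g d)) (window-zero ℓ (suc d) off)) (+-identityʳ (g d))
    where
    off : ∀ j → suc d ≤ j → I (does (d ℕ.≟ j)) * g j ≈ 0#
    off j d<j = I-no (d ℕ.≟ j) (ℕ.<⇒≢ d<j) (g j)
  ... | no d≢s =
    trans (+-cong (I-no (d ℕ.≟ s) d≢s (g s)) (window-δ ℓ (suc s) g s<d d<ℓ+1+s)) (+-identityˡ (g d))
    where
    s<d : s < d
    s<d = ℕ.≤∧≢⇒< s≤d (λ s≡d → d≢s (≡.sym s≡d))
    d<ℓ+1+s : d < ℓ ℕ.+ suc s
    d<ℓ+1+s = ℕ.≤-trans d<ℓ+s (ℕ.≤-reflexive (≡.sym (ℕ.+-suc ℓ s)))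

  window-fibre : ∀ ℓ s (b : Bool) d (g : ℕ → Carrier) → (b ≡ true → s ≤ d × d < ℓ ℕ.+ s) →
                 I b * g d ≈ window s ℓ (λ j → I (b ∧ does (d ℕ.≟ j)) * g j)
  window-fibre ℓ s true  d g bounds with bounds ≡.refl
  ... | s≤d , d<ℓ+s = trans (*-identityˡ (g d)) (sym (window-δ ℓ s g s≤d d<ℓ+s))
  window-fibre ℓ s false d g bounds = trans (zeroˡ (g d)) (sym (window-zero ℓ s (λ j _ → zeroˡ (g j))))

  ∑-window-comm : ∀ {n} ℓ s (f : Fin n → ℕ → Carrier) →
                  ∑[ z < n ] window s ℓ (f z) ≈ window s ℓ (λ j → ∑[ z < n ] f z j)
  ∑-window-comm zero    s f = ∑-zero (λ z → window s zero (f z)) (λ _ → refl)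
  ∑-window-comm (suc ℓ) s f =
    trans (∑-distrib-+ (λ z → f z s) _) (+-congˡ (∑-window-comm ℓ (suc s) f))

  ∑-fibres : ∀ {n} ℓ s (b : Fin n → Bool) (d : Fin n → ℕ) (g : ℕ → Carrier) →
             (∀ z → b z ≡ true → s ≤ d z × d z < ℓ ℕ.+ s) →
             ∑[ z < n ] (I (b z) * g (d z))
               ≈ window s ℓ (λ j → natR R (count (λ z → b z ∧ does (d z ℕ.≟ j))) * g j)
  ∑-fibres {n} ℓ s b d g bounds = begin
    ∑[ z < n ] (I (b z) * g (d z))
      ≈⟨ sum-cong-≋ (λ z → window-fibre ℓ s (b z) (d z) g (bounds z)) ⟩
    ∑[ z < n ] window s ℓ (λ j → I (b z ∧ does (d z ℕ.≟ j)) * g j)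
      ≈⟨ ∑-window-comm ℓ s (λ z j → I (b z ∧ does (d z ℕ.≟ j)) * g j) ⟩
    window s ℓ (λ j → ∑[ z < n ] (I (b z ∧ does (d z ℕ.≟ j)) * g j))
      ≈⟨ window-cong ℓ s (λ j _ → ∑-indicator (λ z → b z ∧ does (d z ℕ.≟ j)) (g j)) ⟩
    window s ℓ (λ j → natR R (count (λ z → b z ∧ does (d z ℕ.≟ j))) * g j)  ∎

module MatrixLemmas {c ℓ} (K : CharZeroField c ℓ) where
  open CharZeroField K hiding (zero)
  open FiniteSums commutativeRing
  open import Algebra.Properties.Semiring.Sum semiring using (sum-cong-≋; ∑-distrib-+; *-distribˡ-sum; sum-syntax)
  open import Algebra.Properties.Ring ring using (-‿distribˡ-*)
  open import Relation.Binary.Reasoning.Setoid setoid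

  sumFin≡∑ : ∀ {n} (f : Fin n → Carrier) → sumFin K f ≡ ∑[ z < n ] f z
  sumFin≡∑ {zero}  f = ≡.refl
  sumFin≡∑ {suc n} f = ≡.cong (f zero +_) (sumFin≡∑ (λ z → f (suc z)))

  *M-shift : ∀ {n} (X Z : Mat K n) θ x y →
             _*M_ K (_-M_ K X (_·M_ K θ (idM K))) Z x y ≈ _*M_ K X Z x y - θ * Z x y
  *M-shift {n} X Z θ x y = begin
    sumFin K (λ z → (X x z - θ * idM K x z) * Z z y)
      ≡⟨ sumFin≡∑ (λ z → (X x z - θ * idM K x z) * Z z y) ⟩
    ∑[ z < n ] ((X x z - θ * idM K x z) * Z z y)
      ≈⟨ sum-cong-≋ split ⟩
    ∑[ z < n ] (X x z * Z z y + - θ * (idM K x z * Z z y))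
      ≈⟨ ∑-distrib-+ (λ z → X x z * Z z y) _ ⟩
    ∑[ z < n ] (X x z * Z z y) + ∑[ z < n ] (- θ * (idM K x z * Z z y))
      ≈⟨ +-cong (reflexive (sumFin≡∑ (λ z → X x z * Z z y)))
                (*-distribˡ-sum (- θ) (λ z → idM K x z * Z z y)) ⟨
    _*M_ K X Z x y + - θ * ∑[ z < n ] (idM K x z * Z z y)
      ≈⟨ +-congˡ (*-congˡ (∑-single _ x diagonal)) ⟩
    _*M_ K X Z x y + - θ * (idM K x x * Z x y)
      ≈⟨ +-congˡ (*-congˡ (I-yes (x ≟ x) ≡.refl (Z x y))) ⟩
    _*M_ K X Z x y + - θ * Z x y
      ≈⟨ +-congˡ (-‿distribˡ-* θ (Z x y)) ⟨
    _*M_ K X Z x y - θ * Z x y ∎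
    where
    split : ∀ z → (X x z - θ * idM K x z) * Z z y ≈ X x z * Z z y + - θ * (idM K x z * Z z y)
    split z = trans (distribʳ (Z z y) (X x z) _)
                    (+-congˡ (trans (*-congʳ (-‿distribˡ-* θ (idM K x z))) (*-assoc (- θ) _ _)))
    diagonal : ∀ z → z ≢ x → idM K x z * Z z y ≈ 0#
    diagonal z z≢x = I-no (x ≟ z) (λ x≡z → z≢x (≡.sym x≡z)) (Z z y)

-- Nothing here depends on the graph G; it is a parameter only because fval takes it.
module CoefficientRecurrence {c ℓ} (K : CharZeroField c ℓ) {n} (G : Graph n) (D : ℕ)
                             (p : ℕ → ℕ → ℕ → ℕ) where
  open CharZeroField K hiding (zero)
  open FieldLemmas K
  open CommutativeRingLemmas commutativeRing
  open import Algebra.Properties.Group +-group using (∙-cancelˡ)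
  open import Algebra.Properties.CommutativeSemigroup *-commutativeSemigroup using (x∙yz≈y∙xz)
  open import Relation.Binary.Reasoning.Setoid setoid

  cK aK bK kK : ℕ → Carrier
  cK i = nat (cN p i)
  aK i = nat (aN p i)
  bK i = nat (bN p i)
  kK i = nat (kN p i)

  -- L h u is the coefficient of A_h in A (Σᵢ uᵢ Aᵢ). Its top term b_h u_{h+1} is split off from
  -- below h u so that a solution can be continued from u_{h-1} and u_h to u_{h+1}.
  below : ℕ → (ℕ → Carrier) → Carrier
  below zero    u = aK 0 * u 0
  below (suc h) u = cK (suc h) * u h + aK (suc h) * u (suc h)

  L : ℕ → (ℕ → Carrier) → Carrier
  L h u = below h u + bK h * u (suc h)

  SolvesRecurrence : Carrier → (ℕ → Carrier) → Set ℓ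
  SolvesRecurrence θ u = ∀ h → h < D → L h u ≈ θ * u h

  solution-unique : (∀ {h} → suc h ≤ D → 1 ≤ bN p h) → ∀ {θ u v γ} →
                    SolvesRecurrence θ u → SolvesRecurrence θ v → u 0 ≈ γ * v 0 →
                    ∀ j → j ≤ D → u j ≈ γ * v j
  solution-unique b-positive {θ} {u} {v} {γ} u-solves v-solves u₀≈γv₀ = agree
    where
    next : ∀ h → suc h ≤ D → below h u ≈ γ * below h v → u h ≈ γ * v h →
           u (suc h) ≈ γ * v (suc h)
    next h h<D below≈ uₕ≈γvₕ = *-cancelˡ-≉0 (nat≉0 (b-positive h<D)) (∙-cancelˡ (below h u) _ _ (begin
      below h u + bK h * u (suc h)           ≈⟨ u-solves h h<D ⟩
      θ * u h                                ≈⟨ x≈γ*y⇒a*x≈γ*[a*y] θ γ uₕ≈γvₕ ⟩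
      γ * (θ * v h)                          ≈⟨ *-congˡ (v-solves h h<D) ⟨
      γ * (below h v + bK h * v (suc h))     ≈⟨ distribˡ γ _ _ ⟩
      γ * below h v + γ * (bK h * v (suc h)) ≈⟨ +-cong below≈ (x∙yz≈y∙xz (bK h) γ _) ⟨
      below h u + bK h * (γ * v (suc h))     ∎))

    consecutive : ∀ h → suc h ≤ D → u h ≈ γ * v h × u (suc h) ≈ γ * v (suc h)
    consecutive zero    1≤D = u₀≈γv₀ , next 0 1≤D (x≈γ*y⇒a*x≈γ*[a*y] (aK 0) γ u₀≈γv₀) u₀≈γv₀
    consecutive (suc h) h<D with consecutive h (ℕ.<⇒≤ h<D)
    ... | uₕ≈γvₕ , uₕ₊₁≈γvₕ₊₁ = uₕ₊₁≈γvₕ₊₁ , next (suc h) h<D below≈ uₕ₊₁≈γvₕ₊₁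
      where
      below≈ : below (suc h) u ≈ γ * below (suc h) v
      below≈ = trans (+-cong (x≈γ*y⇒a*x≈γ*[a*y] (cK (suc h)) γ uₕ≈γvₕ)
                             (x≈γ*y⇒a*x≈γ*[a*y] (aK (suc h)) γ uₕ₊₁≈γvₕ₊₁))
                     (sym (distribˡ γ _ _))

    agree : ∀ j → j ≤ D → u j ≈ γ * v j
    agree zero    _   = u₀≈γv₀
    agree (suc j) j<D = proj₂ (consecutive j j<D)

  belowᵀ : ℕ → (ℕ → Carrier) → Carrier
  belowᵀ zero    f = aK 0 * f 0
  belowᵀ (suc h) f = bK h * f h + aK (suc h) * f (suc h)

  Lᵀ : ℕ → (ℕ → Carrier) → Carrier
  Lᵀ h f = belowᵀ h f + cK (suc h) * f (suc h)

  fval-solvesᵀ : ∀ θ h → ¬ cK (suc h) ≈ 0# → Lᵀ h (fval K G D p θ) ≈ θ * fval K G D p θ h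
  fval-solvesᵀ θ zero c≉0 = begin
    aK 0 * f 0 + cK 1 * f 1                ≈⟨ +-congˡ (x*[y*x⁻¹]≈y _ c≉0) ⟩
    aK 0 * f 0 + (θ - aK 0) * f 0          ≈⟨ a*x+[t-a]*x≈t*x (aK 0) θ (f 0) ⟩
    θ * f 0                                ∎
    where
    f : ℕ → Carrier
    f = fval K G D p θ
  fval-solvesᵀ θ (suc h) c≉0 = begin
    (bK h * f h + aK (suc h) * f (suc h)) + cK (suc (suc h)) * f (suc (suc h))
      ≈⟨ +-congˡ (x*[y*x⁻¹]≈y _ c≉0) ⟩
    (bK h * f h + aK (suc h) * f (suc h)) + ((θ - aK (suc h)) * f (suc h) - bK h * f h)
      ≈⟨ [y+a]+[x-y]≈a+x (bK h * f h) _ _ ⟩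
    aK (suc h) * f (suc h) + (θ - aK (suc h)) * f (suc h)
      ≈⟨ a*x+[t-a]*x≈t*x (aK (suc h)) θ (f (suc h)) ⟩
    θ * f (suc h) ∎
    where
    f : ℕ → Carrier
    f = fval K G D p θ

  normalised : Carrier → ℕ → Carrier
  normalised θ j = fval K G D p θ j * kK j ⁻¹

  k*normalised : ∀ θ {j} → ¬ kK j ≈ 0# → kK j * normalised θ j ≈ fval K G D p θ j
  k*normalised θ {j} k≉0 = x*[y*x⁻¹]≈y (fval K G D p θ j) k≉0

  L-normalised : ∀ θ h → (∀ j → j ≤ suc h → ¬ kK j ≈ 0#) →
                 (∀ m → kK m * bK m ≈ kK (suc m) * cK (suc m)) →
                 kK h * L h (normalised θ) ≈ Lᵀ h (fval K G D p θ)
  L-normalised θ zero k≉0 kb≈kc = begin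
    kK 0 * (aK 0 * y 0 + bK 0 * y 1)           ≈⟨ distribˡ (kK 0) _ _ ⟩
    kK 0 * (aK 0 * y 0) + kK 0 * (bK 0 * y 1)  ≈⟨ +-cong (k*[c*y]≈c′*f refl (k*normalised θ (k≉0 0 z≤n)))
                                                        (k*[c*y]≈c′*f (kb≈kc 0) (k*normalised θ (k≉0 1 ℕ.≤-refl))) ⟩
    aK 0 * f 0 + cK 1 * f 1                    ∎
    where
    f y : ℕ → Carrier
    f = fval K G D p θ
    y = normalised θ
  L-normalised θ (suc h) k≉0 kb≈kc = begin
    kK (suc h) * ((cK (suc h) * y h + aK (suc h) * y (suc h)) + bK (suc h) * y (suc (suc h)))
      ≈⟨ trans (distribˡ (kK (suc h)) _ _) (+-congʳ (distribˡ (kK (suc h)) _ _)) ⟩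
    (kK (suc h) * (cK (suc h) * y h) + kK (suc h) * (aK (suc h) * y (suc h)))
      + kK (suc h) * (bK (suc h) * y (suc (suc h)))
      ≈⟨ +-cong (+-cong (k*[c*y]≈c′*f (sym (kb≈kc h)) (ky (ℕ.≤-trans (ℕ.n≤1+n h) (ℕ.n≤1+n (suc h)))))
                        (k*[c*y]≈c′*f refl (ky (ℕ.n≤1+n (suc h)))))
                (k*[c*y]≈c′*f (kb≈kc (suc h)) (ky ℕ.≤-refl)) ⟩
    (bK h * f h + aK (suc h) * f (suc h)) + cK (suc (suc h)) * f (suc (suc h)) ∎
    where
    f y : ℕ → Carrier
    f = fval K G D p θ
    y = normalised θ
    ky : ∀ {j} → j ≤ suc (suc h) → kK j * y j ≈ f j
    ky {j} j≤ = k*normalised θ (k≉0 j j≤)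

  normalised-solves : ∀ θ → (∀ {m} → suc m ≤ D → 1 ≤ cN p (suc m)) →
                      (∀ {m} → m ≤ D → 1 ≤ kN p m) →
                      (∀ m → kN p m ℕ.* bN p m ≡ kN p (suc m) ℕ.* cN p (suc m)) →
                      SolvesRecurrence θ (normalised θ)
  normalised-solves θ c-positive k-positive k-relation h h<D =
    *-cancelˡ-≉0 (k≉0 h (ℕ.<⇒≤ h<D)) (begin
      kK h * L h y                ≈⟨ L-normalised θ h (λ j j≤1+h → k≉0 j (ℕ.≤-trans j≤1+h h<D)) kb≈kc ⟩
      Lᵀ h f                      ≈⟨ fval-solvesᵀ θ h (nat≉0 (c-positive h<D)) ⟩
      θ * f h                     ≈⟨ *-congˡ (k*normalised θ (k≉0 h (ℕ.<⇒≤ h<D))) ⟨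
      θ * (kK h * y h)            ≈⟨ x∙yz≈y∙xz θ (kK h) (y h) ⟩
      kK h * (θ * y h)            ∎)
    where
    f y : ℕ → Carrier
    f = fval K G D p θ
    y = normalised θ
    k≉0 : ∀ j → j ≤ D → ¬ kK j ≈ 0#
    k≉0 j j≤D = nat≉0 (k-positive j≤D)
    kb≈kc : ∀ m → kK m * bK m ≈ kK (suc m) * cK (suc m)
    kb≈kc m = trans (sym (natR-* (kN p m) (bN p m)))
                    (trans (reflexive (≡.cong nat (k-relation m))) (natR-* (kN p (suc m)) (cN p (suc m))))

  normalised₀*k₀≈1 : ∀ θ → ¬ kK 0 ≈ 0# → normalised θ 0 * kK 0 ≈ 1#
  normalised₀*k₀≈1 θ k₀≉0 = trans (*-comm _ _) (k*normalised θ k₀≉0)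

module BoseMesner {c ℓ} (K : CharZeroField c ℓ) {n} {G : Graph n} {D} {p : ℕ → ℕ → ℕ → ℕ}
                  (drg : IsDRG G D p) where
  open CharZeroField K hiding (zero)
  open IsDRG drg using (intersect)
  open DistanceRegular drg
  open FiniteSums commutativeRing
  open MatrixLemmas K
  open CoefficientRecurrence K G D p
  open import Algebra.Properties.Semiring.Sum semiring using (sum-cong-≋; sum-syntax)
  open import Algebra.Properties.Group +-group using (x≈y⇒x∙y⁻¹≈ε; x∙y⁻¹≈ε⇒x≈y)
  open import Relation.Binary.Reasoning.Setoid setoid

  combination : (ℕ → Carrier) → Mat K n
  combination α = sumTo K D (λ i → _·M_ K (α i) (distMat K G D p i))

  A-θI : Carrier → Mat K n
  A-θI θ = _-M_ K (adjMat K G D p) (_·M_ K θ (idM K))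

  *-distMat-on : ∀ a {i x y} → dist x y ≡ i → a * distMat K G D p i x y ≈ a
  *-distMat-on a xy≡i = trans (*-congˡ (reflexive (≡.cong I (distIs-at xy≡i)))) (*-identityʳ a)

  *-distMat-off : ∀ a {i x y} → i ≢ dist x y → a * distMat K G D p i x y ≈ 0#
  *-distMat-off a i≢xy = trans (*-congˡ (reflexive (≡.cong I (distIs-off i≢xy)))) (zeroʳ a)

  sumTo-above : ∀ (α : ℕ → Carrier) N {x y} → N < dist x y →
                sumTo K N (λ i → _·M_ K (α i) (distMat K G D p i)) x y ≈ 0#
  sumTo-above α zero    N<d = *-distMat-off (α 0) (ℕ.<⇒≢ N<d)
  sumTo-above α (suc N) N<d =
    trans (+-cong (sumTo-above α N (ℕ.<-trans (ℕ.n<1+n N) N<d)) (*-distMat-off (α (suc N)) (ℕ.<⇒≢ N<d)))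
          (+-identityʳ 0#)

  sumTo-at : ∀ (α : ℕ → Carrier) N {x y} → dist x y ≤ N →
             sumTo K N (λ i → _·M_ K (α i) (distMat K G D p i)) x y ≈ α (dist x y)
  sumTo-at α zero d≤0 = trans (*-distMat-on (α 0) d≡0) (reflexive (≡.cong α (≡.sym d≡0)))
    where d≡0 = ℕ.n≤0⇒n≡0 d≤0
  sumTo-at α (suc N) {x} {y} d≤1+N with ℕ.m≤n⇒m<n∨m≡n d≤1+N
  ... | inj₁ d<1+N = trans (+-cong (sumTo-at α N (ℕ.≤-pred d<1+N))
                                   (*-distMat-off (α (suc N)) (λ 1+N≡d → ℕ.<⇒≢ d<1+N (≡.sym 1+N≡d))))
                           (+-identityʳ _)
  ... | inj₂ d≡1+N = trans (+-cong (sumTo-above α N (ℕ.≤-reflexive (≡.sym d≡1+N)))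
                                   (*-distMat-on (α (suc N)) d≡1+N))
                           (trans (+-identityˡ _) (reflexive (≡.cong α (≡.sym d≡1+N))))

  combination-entry : ∀ α x y → combination α x y ≈ α (dist x y)
  combination-entry α x y = sumTo-at α D (dist≤D x y)

  adjacency-window : ∀ {x y h} ℓ s (g : ℕ → Carrier) (Z : Mat K n) → dist x y ≡ h →
                     (∀ z → Z z y ≈ g (dist z y)) →
                     (∀ z → dist x z ≡ 1 → s ≤ dist z y × dist z y < ℓ ℕ.+ s) →
                     _*M_ K (adjMat K G D p) Z x y ≈ window s ℓ (λ j → nat (p h 1 j) * g j)
  adjacency-window {x} {y} {h} ℓ s g Z xy≡h Z≈g bounds = begin
    sumFin K (λ z → distMat K G D p 1 x z * Z z y)
      ≡⟨ sumFin≡∑ (λ z → distMat K G D p 1 x z * Z z y) ⟩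
    ∑[ z < n ] (I (distIs G 1 x z) * Z z y)
      ≈⟨ sum-cong-≋ (λ z → *-congˡ (Z≈g z)) ⟩
    ∑[ z < n ] (I (distIs G 1 x z) * g (dist z y))
      ≈⟨ ∑-fibres ℓ s (distIs G 1 x) (λ z → dist z y) g
                  (λ z xz → bounds z (≡.sym (distIs⇒≡dist xz))) ⟩
    window s ℓ (λ j → nat (count (λ z → distIs G 1 x z ∧ does (dist z y ℕ.≟ j))) * g j)
      ≈⟨ window-cong ℓ s (λ j _ → *-congʳ (reflexive (≡.cong nat (neighbours-at j)))) ⟩
    window s ℓ (λ j → nat (p h 1 j) * g j) ∎
    where
    neighbours-at : ∀ j → count (λ z → distIs G 1 x z ∧ does (dist z y ℕ.≟ j)) ≡ p h 1 j
    neighbours-at j = ≡.trans (count-cong (λ z → ≡.cong (distIs G 1 x z ∧_) (≡.sym (distIs≡ j z y))))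
                              (≡.subst (λ d → _ ≡ p d 1 j) xy≡h (intersect _ 1 j x y (distIs-dist x y)))

  adjacency-action : ∀ x y (g : ℕ → Carrier) (Z : Mat K n) → (∀ z → Z z y ≈ g (dist z y)) →
                     _*M_ K (adjMat K G D p) Z x y ≈ L (dist x y) g
  adjacency-action x y g Z Z≈g with dist x y in xy≡h
  ... | zero = trans (adjacency-window 2 0 g Z xy≡h Z≈g bounds) (+-congˡ (+-identityʳ _))
    where
    bounds : ∀ z → dist x z ≡ 1 → 0 ≤ dist z y × dist z y < 2
    bounds z xz≡1 = z≤n , s≤s (≡.subst (λ d → dist z y ≤ suc d) xy≡h (proj₂ (neighbour-dist y xz≡1)))
  ... | suc m = trans (adjacency-window 3 m g Z xy≡h Z≈g bounds)
                      (trans (+-congˡ (+-congˡ (+-identityʳ _))) (sym (+-assoc _ _ _)))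
    where
    bounds : ∀ z → dist x z ≡ 1 → m ≤ dist z y × dist z y < 3 ℕ.+ m
    bounds z xz≡1 = ℕ.≤-pred (≡.subst (_≤ suc (dist z y)) xy≡h (proj₁ (neighbour-dist y xz≡1)))
                  , s≤s (≡.subst (λ d → dist z y ≤ suc d) xy≡h (proj₂ (neighbour-dist y xz≡1)))

  shifted-action : ∀ θ x y (g : ℕ → Carrier) (Z : Mat K n) → (∀ z → Z z y ≈ g (dist z y)) →
                   _*M_ K (A-θI θ) Z x y ≈ L (dist x y) g - θ * g (dist x y)
  shifted-action θ x y g Z Z≈g =
    trans (*M-shift (adjMat K G D p) Z θ x y)
          (+-cong (adjacency-action x y g Z Z≈g) (-‿cong (*-congˡ (Z≈g x))))

  combination-∈Mθ : ∀ {θ α} → SolvesRecurrence θ α → InMθ K G D p θ (combination α)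
  combination-∈Mθ {θ} {α} α-solves = (α , λ _ _ → refl) , β , entry
    where
    β : Carrier
    β = L D α - θ * α D
    shifted-combination : ∀ x y → _*M_ K (A-θI θ) (combination α) x y ≈ L (dist x y) α - θ * α (dist x y)
    shifted-combination x y = shifted-action θ x y α (combination α) (λ z → combination-entry α z y)
    entry : ∀ x y → _*M_ K (A-θI θ) (combination α) x y ≈ β * distMat K G D p D x y
    entry x y with ℕ.m≤n⇒m<n∨m≡n (dist≤D x y)
    ... | inj₁ d<D = begin
      _*M_ K (A-θI θ) (combination α) x y        ≈⟨ shifted-combination x y ⟩
      L (dist x y) α - θ * α (dist x y)          ≈⟨ x≈y⇒x∙y⁻¹≈ε (α-solves _ d<D) ⟩
      0#                                         ≈⟨ *-distMat-off β (λ D≡d → ℕ.<⇒≢ d<D (≡.sym D≡d)) ⟨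
      β * distMat K G D p D x y                  ∎
    ... | inj₂ d≡D = begin
      _*M_ K (A-θI θ) (combination α) x y        ≈⟨ shifted-combination x y ⟩
      L (dist x y) α - θ * α (dist x y)          ≡⟨ ≡.cong (λ h → L h α - θ * α h) d≡D ⟩
      β                                          ≈⟨ *-distMat-on β d≡D ⟨
      β * distMat K G D p D x y                  ∎

  ∈Mθ⇒solves : ∀ {θ α β} {Z : Mat K n} → (∀ x y → Z x y ≈ combination α x y) →
               (∀ x y → _*M_ K (A-θI θ) Z x y ≈ β * distMat K G D p D x y) → SolvesRecurrence θ α
  ∈Mθ⇒solves {θ} {α} {β} {Z} Z≈ shifted≈ h h<D with at-distance (ℕ.<⇒≤ h<D)
  ... | z , zy≡h = x∙y⁻¹≈ε⇒x≈y _ _ (begin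
    L h α - θ * α h                       ≡⟨ ≡.cong (λ d → L d α - θ * α d) zy≡h ⟨
    L (dist z y₀) α - θ * α (dist z y₀)
      ≈⟨ shifted-action θ z y₀ α Z (λ w → trans (Z≈ w y₀) (combination-entry α w y₀)) ⟨
    _*M_ K (A-θI θ) Z z y₀
      ≈⟨ shifted≈ z y₀ ⟩
    β * distMat K G D p D z y₀
      ≈⟨ *-distMat-off β (λ D≡d → ℕ.<⇒≢ h<D (≡.trans (≡.sym zy≡h) (≡.sym D≡d))) ⟩
    0# ∎)

  solution-basis : ∀ {θ v w} → SolvesRecurrence θ v → v 0 * w ≈ 1# →
                   IsBasis1 K (InMθ K G D p θ) (combination v)
  solution-basis {θ} {v} {w} v-solves v₀w≈1 = combination-∈Mθ v-solves , independent , spanning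
    where
    independent : ∀ γ → _≈M_ K (_·M_ K γ (combination v)) (zeroM K) → γ ≈ 0#
    independent γ γv≈0 = begin
      γ                  ≈⟨ *-identityʳ γ ⟨
      γ * 1#             ≈⟨ *-congˡ v₀w≈1 ⟨
      γ * (v 0 * w)      ≈⟨ *-assoc γ (v 0) w ⟨
      (γ * v 0) * w      ≈⟨ *-congʳ γv₀≈0 ⟩
      0# * w             ≈⟨ zeroˡ w ⟩
      0#                 ∎
      where
      γv₀≈0 : γ * v 0 ≈ 0#
      γv₀≈0 = begin
        γ * v 0                      ≡⟨ ≡.cong (λ d → γ * v d) (dist-refl y₀) ⟨
        γ * v (dist y₀ y₀)           ≈⟨ *-congˡ (combination-entry v y₀ y₀) ⟨
        γ * combination v y₀ y₀      ≈⟨ γv≈0 y₀ y₀ ⟩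
        0#                           ∎

    spanning : ∀ Z → InMθ K G D p θ Z → Σ Carrier λ γ → _≈M_ K Z (_·M_ K γ (combination v))
    spanning Z ((α , Z≈) , β , shifted≈) = α 0 * w , λ x y → begin
      Z x y                        ≈⟨ trans (Z≈ x y) (combination-entry α x y) ⟩
      α (dist x y)                 ≈⟨ solution-unique b-positive (∈Mθ⇒solves Z≈ shifted≈) v-solves
                                                      α₀≈γv₀ (dist x y) (dist≤D x y) ⟩
      (α 0 * w) * v (dist x y)     ≈⟨ *-congˡ (combination-entry v x y) ⟨
      (α 0 * w) * combination v x y ∎
      where
      α₀≈γv₀ : α 0 ≈ (α 0 * w) * v 0
      α₀≈γv₀ = begin
        α 0                  ≈⟨ *-identityʳ (α 0) ⟨
        α 0 * 1#             ≈⟨ *-congˡ (trans (*-comm w (v 0)) v₀w≈1) ⟨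
        α 0 * (w * v 0)      ≈⟨ *-assoc (α 0) w (v 0) ⟨
        (α 0 * w) * v 0      ∎

corollary6p3 : ∀ {c ℓ} (K : CharZeroField c ℓ) {n : ℕ} (G : Graph n)
                 (D : ℕ) (p : ℕ → ℕ → ℕ → ℕ) → IsDRG G D p → 3 ≤ D →
                 (θ : CharZeroField.Carrier K) →
                 IsBasis1 K (InMθ K G D p θ) (Yθ K G D p θ)
corollary6p3 K G D p drg _ θ =
  solution-basis (normalised-solves θ c-positive k-positive k-relation)
                 (normalised₀*k₀≈1 θ (nat≉0 (k-positive z≤n)))
  where
  open BoseMesner K drg
  open DistanceRegular drg
  open CoefficientRecurrence K G D p
  open FieldLemmas K
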